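{- Let $M$ be a sharp, integral monoid, let $\phi:\Gamma\to\Gamma'$ be a harmonic, non-degenerate morphism of $M$-metrised graphs, and let $\Delta,\Delta'$ be the Laplacians of $\Gamma,\Gamma'$. Then $\phi^*\circ\Delta'=\Delta\circ\phi^*$ as maps $\operatorname{PL}(\Gamma')\to\operatorname{Div}(\Gamma)$.
   Context: Monoids: commutative, sharp (only $0$ invertible), integral (cancellative); $M^{gp}$ groupification. A graph is $(X,r,i)$: $X$ finite, $r$ idempotent, $i$ involution, $i(x)=x\iff r(x)=x$; vertices $V$ = fixed points, half-edges $H=X\setminus V$, $H_v=\{e:r(e)=v\}$; connected. $M$-metrised: $l:X\to M$, $l\circ i=l$, $l(x)=0\iff x\in V$. $\operatorname{Div}(\Gamma)$ is the free abelian group on $V$. $\operatorname{PL}(\Gamma)=\{g:V\to M^{gp}: g(r(e))-g(r(i(e)))\in\langle l(e)\rangle\ \forall e\in H\}$; $\Delta(g)=\sum_v\sum_{e\in H_v}\frac{g(v)-g(r(i(e)))}{l(e)}[v]$. A morphism $\phi:X\to X'$ sends vertices to vertices, and each half-edge $e$ either to a half-edge $e'$ with $\phi(r(e))=r'(e')$, $\phi(r(i(e)))=r'(i'(e'))$, $l'(e')\in\langle l(e)\rangle$, or to a vertex $v'$ with $\phi(r(e))=\phi(r(i(e)))=v'$. Slope $\mu_\phi(e)=l'(\phi(e))/l(e)$ or $0$; $m_{\phi,v}(e')=\sum_{e\in H_v,\phi(e)=e'}\mu_\phi(e)$ for $e'\in H'_{\phi(v)}$; $\phi$ is harmonic if this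 is independent of $e'$, with value $m_\phi(v)$; non-degenerate if $m_\phi(v)>0$ for all $v$. Pullbacks: $\phi^*(D')=\sum_{v\in V}D'(\phi(v))m_\phi(v)[v]$ on divisors and $\phi^*(g)=g\circ\phi|_V$ on $\operatorname{PL}(\Gamma')$ (which lands in $\operatorname{PL}(\Gamma)$). -}

module Defs where

open import Level using (_⊔_)
open import Algebra.Bundles using (CommutativeMonoid)
open import Data.Nat as ℕ using (ℕ; zero; suc)
open import Data.Integer as ℤ using (ℤ; +_; -[1+_])
open import Data.Fin using (Fin; zero; suc)
open import Data.Fin.Properties using (_≟_)
open import Data.Product using (Σ; ∃; _×_; _,_; proj₁; proj₂)
open import Data.Sum using (_⊎_; inj₁; inj₂; [_,_])
open import Relation.Nullary using (¬_; yes; no)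
open import Relation.Binary.PropositionalEquality using (_≡_)

Σℤ : ∀ {n} → (Fin n → ℤ) → ℤ
Σℤ {zero} f = + 0
Σℤ {suc n} f = f zero ℤ.+ Σℤ (λ j → f (suc j))

Σℕ : ∀ {n} → (Fin n → ℕ) → ℕ
Σℕ {zero} f = 0
Σℕ {suc n} f = f zero ℕ.+ Σℕ (λ j → f (suc j))

data Reach {n : ℕ} (r i : Fin n → Fin n) : Fin n → Fin n → Set where
  here : ∀ {v w} → v ≡ w → Reach r i v w
  step : ∀ {v w} (e : Fin n) → r e ≡ v → ¬ (r e ≡ e) → Reach r i (r (i e)) w → Reach r i v w

module _ {c ℓ} (M : CommutativeMonoid c ℓ) where
  open CommutativeMonoid M renaming (Carrier to A)

  IsSharp : Set (c ⊔ ℓ)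
  IsSharp = ∀ x y → x ∙ y ≈ ε → x ≈ ε

  IsIntegral : Set (c ⊔ ℓ)
  IsIntegral = ∀ x y z → x ∙ z ≈ y ∙ z → x ≈ y

  -- groupification M^gp: formal differences (a , b) = a - b
  Gp : Set c
  Gp = A × A

  _≈ᵍ_ : Gp → Gp → Set (c ⊔ ℓ)
  (a , b) ≈ᵍ (a' , b') = ∃ λ k → (a ∙ b') ∙ k ≈ (a' ∙ b) ∙ k

  _⊖_ : Gp → Gp → Gp
  (a , b) ⊖ (a' , b') = (a ∙ b' , b ∙ a')

  _×ₘ_ : ℕ → A → A
  zero ×ₘ x = ε
  suc n ×ₘ x = x ∙ (n ×ₘ x)

  _·_ : ℤ → A → Gp
  (+ n) · x = (n ×ₘ x , ε)
  (-[1+ n ]) · x = (ε , suc n ×ₘ x)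

  record MGraph : Set (c ⊔ ℓ) where
    field
      size     : ℕ
      r        : Fin size → Fin size
      i        : Fin size → Fin size
      r-idem   : ∀ x → r (r x) ≡ r x
      i-invol  : ∀ x → i (i x) ≡ x
      i-fix    : ∀ x → (i x ≡ x → r x ≡ x) × (r x ≡ x → i x ≡ x)
      connected : ∀ v w → r v ≡ v → r w ≡ w → Reach r i v w
      l        : Fin size → A
      l-i      : ∀ x → l (i x) ≈ l x
      l-zero   : ∀ x → (l x ≈ ε → r x ≡ x) × (r x ≡ x → l x ≈ ε)

  open MGraph public

  IsVertex : (Γ : MGraph) → Fin (size Γ) → Set
  IsVertex Γ x = r Γ x ≡ x

  V : MGraph → Set
  V Γ = Σ (Fin (size Γ)) (IsVertex Γ)

  rV : (Γ : MGraph) → Fin (size Γ) → V Γ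
  rV Γ x = r Γ x , r-idem Γ x

  Div : MGraph → Set
  Div Γ = V Γ → ℤ

  IsPL : (Γ : MGraph) → (V Γ → Gp) → Set (c ⊔ ℓ)
  IsPL Γ g = ∀ e → ¬ IsVertex Γ e →
    Σ ℤ λ k → (g (rV Γ e) ⊖ g (rV Γ (i Γ e))) ≈ᵍ (k · l Γ e)

  lapTerm : (Γ : MGraph) (g : V Γ → Gp) → IsPL Γ g → V Γ → Fin (size Γ) → ℤ
  lapTerm Γ g p v x with r Γ x ≟ proj₁ v | r Γ x ≟ x
  ... | yes _ | no h = proj₁ (p x h)
  ... | _     | _    = + 0

  -- Laplacian Δ(g)(v) = Σ_{e ∈ H_v} (g(v) - g(r(i e))) / l(e)
  Lap : (Γ : MGraph) (g : V Γ → Gp) → IsPL Γ g → Div Γ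
  Lap Γ g p v = Σℤ (lapTerm Γ g p v)

  record Morphism (Γ Γ' : MGraph) : Set (c ⊔ ℓ) where
    field
      map  : Fin (size Γ) → Fin (size Γ')
      vert : ∀ x → IsVertex Γ x → IsVertex Γ' (map x)
      edge : ∀ e → ¬ IsVertex Γ e →
        (¬ IsVertex Γ' (map e)
          × map (r Γ e) ≡ r Γ' (map e)
          × map (r Γ (i Γ e)) ≡ r Γ' (i Γ' (map e))
          × Σ ℕ (λ k → l Γ' (map e) ≈ k ×ₘ l Γ e))
        ⊎ (IsVertex Γ' (map e)
          × map (r Γ e) ≡ map e
          × map (r Γ (i Γ e)) ≡ map e)

  open Morphism public

  module _ {Γ Γ' : MGraph} (φ : Morphism Γ Γ') where
    -- slope μ_φ(e) = l'(φ e) / l(e), or 0 if e is contracted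
    slope : ∀ e → ¬ IsVertex Γ e → ℕ
    slope e h = [ (λ t → proj₁ (proj₂ (proj₂ (proj₂ t)))) , (λ _ → 0) ] (edge φ e h)

    mTerm : V Γ → Fin (size Γ') → Fin (size Γ) → ℕ
    mTerm v e' x with r Γ x ≟ proj₁ v | r Γ x ≟ x | map φ x ≟ e'
    ... | yes _ | no h | yes _ = slope x h
    ... | _     | _    | _     = 0

    -- m_{φ,v}(e') = Σ_{e ∈ H_v, φ(e) = e'} μ_φ(e)
    mLoc : V Γ → Fin (size Γ') → ℕ
    mLoc v e' = Σℕ (mTerm v e')

    pullV : V Γ → V Γ'
    pullV (x , h) = map φ x , vert φ x h

    IsHarmonicWith : (V Γ → ℕ) → Set
    IsHarmonicWith m = ∀ (v : V Γ) e' → r Γ' e' ≡ map φ (proj₁ v) → ¬ IsVertex Γ' e' →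
      mLoc v e' ≡ m v

    IsNonDegenerate : (V Γ → ℕ) → Set
    IsNonDegenerate m = ∀ v → 0 ℕ.< m v

    pullDiv : (V Γ → ℕ) → Div Γ' → Div Γ
    pullDiv m D' v = D' (pullV v) ℤ.* + m v

    pullPL : (V Γ' → Gp) → (V Γ → Gp)
    pullPL g' v = g' (pullV v)

-- For a half-edge x at v, the slope of φ*g' along x is μ_φ(x) times the slope of g' along φ(x)
-- (and 0 if x is contracted, since then g' ∘ φ is constant on the ends of x). Slopes are well
-- defined because in a sharp integral monoid n ↦ n · l(x) is injective when l(x) ≠ 0. Summing over
-- x ∈ H_v, grouping the terms by a = φ(x) and using harmonicity Σ_{φ(x) = a} μ_φ(x) = m_φ(v) for
-- a ∈ H'_{φ(v)} gives Δ(φ*g')(v) = m_φ(v) Δ'(g')(φ(v)).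
module Submission where

open import Defs
open import Algebra.Bundles using (CommutativeMonoid; Monoid)
open import Data.Nat using (ℕ)
open import Relation.Binary.PropositionalEquality using (_≡_)

open import Data.Nat as ℕ using (zero; suc)
import Data.Nat.Properties as ℕ
open import Data.Integer as ℤ using (ℤ; +_; -[1+_])
import Data.Integer.Properties as ℤ
open import Data.Fin using (Fin; zero; suc)
open import Data.Fin.Properties using (_≟_; suc-injective)
open import Data.Product using (_,_; proj₁; proj₂)
open import Relation.Nullary.Decidable using (_×-dec_)
open import Data.Sum using (inj₁; inj₂)
open import Data.Empty using (⊥-elim)
open import Function using (_∘_)
open import Relation.Nullary using (¬_; Dec; yes; no; ¬?)
import Relation.Binary.PropositionalEquality as ≡
open ≡ using (_≢_; module ≡-Reasoning)
open import Axiom.UniquenessOfIdentityProofs using (module Decidable⇒UIP)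

module _ {a ℓ} (M : Monoid a ℓ) where
  open Monoid M
  open import Algebra.Properties.Monoid.Sum M

  sum-zero : ∀ {n} (f : Fin n → Carrier) → (∀ j → f j ≈ ε) → sum f ≈ ε
  sum-zero {n} f f≈ε = trans (sum-cong-≋ f≈ε) (sum-replicate-zero n)

  sum-single : ∀ {n} (f : Fin n → Carrier) i → (∀ j → j ≢ i → f j ≈ ε) → sum f ≈ f i
  sum-single f zero f≈ε = trans (∙-congˡ (sum-zero (f ∘ suc) (λ j → f≈ε (suc j) λ ()))) (identityʳ _)
  sum-single f (suc i) f≈ε =
    trans (∙-congʳ (f≈ε zero λ ())) (trans (identityˡ _)
      (sum-single (f ∘ suc) i (λ j j≢i → f≈ε (suc j) (j≢i ∘ suc-injective))))

open import Algebra.Properties.Semiring.Sum ℤ.+-*-semiring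
  using (sum; sum-cong-≗; ∑-comm; *-distribˡ-sum; *-distribʳ-sum)

Σℤ≡sum : ∀ {n} (f : Fin n → ℤ) → Σℤ f ≡ sum f
Σℤ≡sum {zero} f = ≡.refl
Σℤ≡sum {suc n} f = ≡.cong (λ s → f zero ℤ.+ s) (Σℤ≡sum (f ∘ suc))

pos-Σℕ : ∀ {n} (f : Fin n → ℕ) → + Σℕ f ≡ sum (+_ ∘ f)
pos-Σℕ {zero} f = ≡.refl
pos-Σℕ {suc n} f = ≡.cong (λ s → + f zero ℤ.+ s) (pos-Σℕ (f ∘ suc))

module Groupification {c ℓ} (M : CommutativeMonoid c ℓ) (sharp : IsSharp M) (integral : IsIntegral M) where
  open CommutativeMonoid M renaming (Carrier to A)
  open import Algebra.Solver.CommutativeMonoid M using (solve; _⊕_; _⊜_)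

  infixr 8 _×_
  _×_ : ℕ → A → A
  _×_ = _×ₘ_ M

  ×-congʳ : ∀ n {x y} → x ≈ y → n × x ≈ n × y
  ×-congʳ zero    x≈y = refl
  ×-congʳ (suc n) x≈y = ∙-cong x≈y (×-congʳ n x≈y)

  ×-homo-+ : ∀ x m n → (m ℕ.+ n) × x ≈ m × x ∙ n × x
  ×-homo-+ x zero    n = sym (identityˡ _)
  ×-homo-+ x (suc m) n = trans (∙-congˡ (×-homo-+ x m n)) (sym (assoc _ _ _))

  ×-assocˡ : ∀ x m n → m × (n × x) ≈ (m ℕ.* n) × x
  ×-assocˡ x zero    n = refl
  ×-assocˡ x (suc m) n = trans (∙-congˡ (×-assocˡ x m n)) (sym (×-homo-+ x n (m ℕ.* n)))

  ×-zeroʳ : ∀ n → n × ε ≈ ε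
  ×-zeroʳ zero    = refl
  ×-zeroʳ (suc n) = trans (identityˡ _) (×-zeroʳ n)

  ×-cancelʳ : ∀ {x} → ¬ x ≈ ε → ∀ m n → m × x ≈ n × x → m ≡ n
  ×-cancelʳ x≉ε zero    zero    eq = ≡.refl
  ×-cancelʳ x≉ε zero    (suc n) eq = ⊥-elim (x≉ε (sharp _ _ (sym eq)))
  ×-cancelʳ x≉ε (suc m) zero    eq = ⊥-elim (x≉ε (sharp _ _ eq))
  ×-cancelʳ {x} x≉ε (suc m) (suc n) eq =
    ≡.cong suc (×-cancelʳ x≉ε m n (integral _ _ x (trans (comm _ x) (trans eq (comm x _)))))

  ×-sum-cancelʳ : ∀ {x} → ¬ x ≈ ε → ∀ m n m' n' →
                  m × x ∙ n × x ≈ m' × x ∙ n' × x → m ℕ.+ n ≡ m' ℕ.+ n'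
  ×-sum-cancelʳ {x} x≉ε m n m' n' eq =
    ×-cancelʳ x≉ε _ _ (trans (×-homo-+ x m n) (trans eq (sym (×-homo-+ x m' n'))))

  infix 4 _≃_
  _≃_ : Gp M → Gp M → Set ℓ
  (a , b) ≃ (a' , b') = a ∙ b' ≈ a' ∙ b

  ≈ᵍ⇒≃ : ∀ {X Y} → _≈ᵍ_ M X Y → X ≃ Y
  ≈ᵍ⇒≃ (k , eq) = integral _ _ k eq

  ≃-reflexive : ∀ {X Y} → X ≡ Y → X ≃ Y
  ≃-reflexive ≡.refl = refl

  ≃-sym : ∀ {X Y} → X ≃ Y → Y ≃ X
  ≃-sym = sym

  ≃-trans : ∀ {X Y Z} → X ≃ Y → Y ≃ Z → X ≃ Z
  ≃-trans {a , b} {a' , b'} {a'' , b''} X≃Y Y≃Z = integral _ _ b' (begin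
    (a ∙ b'') ∙ b'  ≈⟨ swap a b'' b' ⟩
    (a ∙ b') ∙ b''  ≈⟨ ∙-congʳ X≃Y ⟩
    (a' ∙ b) ∙ b''  ≈⟨ swap a' b b'' ⟩
    (a' ∙ b'') ∙ b  ≈⟨ ∙-congʳ Y≃Z ⟩
    (a'' ∙ b') ∙ b  ≈⟨ swap a'' b' b ⟩
    (a'' ∙ b) ∙ b'  ∎)
    where
    open import Relation.Binary.Reasoning.Setoid setoid
    swap : ∀ x y z → (x ∙ y) ∙ z ≈ (x ∙ z) ∙ y
    swap = solve 3 (λ x y z → (x ⊕ y) ⊕ z ⊜ (x ⊕ z) ⊕ y) refl

  ⊖-self : ∀ X z → _⊖_ M X X ≃ _·_ M (+ 0) z
  ⊖-self (a , b) z = trans (identityʳ _) (trans (comm a b) (sym (identityˡ _)))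

  ·-congʳ : ∀ k {x y} → x ≈ y → _·_ M k x ≃ _·_ M k y
  ·-congʳ (+ n)    x≈y = ∙-congʳ (×-congʳ n x≈y)
  ·-congʳ -[1+ n ] x≈y = ∙-congˡ (sym (×-congʳ (suc n) x≈y))

  ·-assoc : ∀ k μ x → _·_ M k (μ × x) ≃ _·_ M (k ℤ.* + μ) x
  ·-assoc (+ n) μ x rewrite ≡.sym (ℤ.pos-* n μ) = ∙-congʳ (×-assocˡ x n μ)
  ·-assoc -[1+ n ] zero x rewrite ℤ.*-zeroʳ -[1+ n ] =
    trans (identityˡ ε) (sym (trans (identityˡ _) (×-zeroʳ (suc n))))
  ·-assoc -[1+ n ] (suc μ) x = ∙-congˡ (sym (×-assocˡ x (suc n) (suc μ)))

  ·-cancelʳ : ∀ {x} → ¬ x ≈ ε → ∀ k k' → _·_ M k x ≃ _·_ M k' x → k ≡ k'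
  ·-cancelʳ x≉ε (+ m) (+ n) eq =
    ≡.cong +_ (ℕ.+-cancelʳ-≡ 0 m n (×-sum-cancelʳ x≉ε m 0 n 0 eq))
  ·-cancelʳ x≉ε (+ m) -[1+ n ] eq
    with () ← ≡.trans (≡.sym (ℕ.+-suc m n)) (×-sum-cancelʳ x≉ε m (suc n) 0 0 eq)
  ·-cancelʳ x≉ε -[1+ m ] (+ n) eq
    with () ← ≡.trans (×-sum-cancelʳ x≉ε 0 0 n (suc m) eq) (ℕ.+-suc n m)
  ·-cancelʳ x≉ε -[1+ m ] -[1+ n ] eq =
    ≡.cong -[1+_] (≡.sym (ℕ.suc-injective (×-sum-cancelʳ x≉ε 0 (suc n) 0 (suc m) eq)))

module Laplacian {c ℓ} (M : CommutativeMonoid c ℓ) (sharp : IsSharp M) (integral : IsIntegral M) where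
  open CommutativeMonoid M using (_≈_; ε; sym; trans)
  open Groupification M sharp integral
  open import Data.Product using (_×_)

  length≉ε : (Γ : MGraph M) {e : Fin (size Γ)} → ¬ IsVertex M Γ e → ¬ l Γ e ≈ ε
  length≉ε Γ {e} e∉V = e∉V ∘ proj₁ (l-zero Γ e)

  V-≡ : (Γ : MGraph M) {u w : V M Γ} → proj₁ u ≡ proj₁ w → u ≡ w
  V-≡ Γ {x , _} {.x , _} ≡.refl = ≡.cong (x ,_) (Decidable⇒UIP.≡-irrelevant _≟_ _ _)

  HalfEdgeAt : (Γ : MGraph M) → V M Γ → Fin (size Γ) → Set
  HalfEdgeAt Γ v x = r Γ x ≡ proj₁ v × ¬ IsVertex M Γ x

  halfEdgeAt? : (Γ : MGraph M) (v : V M Γ) (x : Fin (size Γ)) → Dec (HalfEdgeAt Γ v x)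
  halfEdgeAt? Γ v x = (r Γ x ≟ proj₁ v) ×-dec ¬? (r Γ x ≟ x)

  module _ (Γ : MGraph M) (g : V M Γ → Gp M) (p : IsPL M Γ g) where

    slope-unique : ∀ e (e∉V : ¬ IsVertex M Γ e) k →
                   _⊖_ M (g (rV M Γ e)) (g (rV M Γ (i Γ e))) ≃ _·_ M k (l Γ e) →
                   proj₁ (p e e∉V) ≡ k
    slope-unique e e∉V k eq =
      ·-cancelʳ (length≉ε Γ e∉V) _ _ (≃-trans (≃-sym (≈ᵍ⇒≃ (proj₂ (p e e∉V)))) eq)

    slope-irrelevant : ∀ e (e∉V e∉V' : ¬ IsVertex M Γ e) → proj₁ (p e e∉V) ≡ proj₁ (p e e∉V')
    slope-irrelevant e e∉V e∉V' = slope-unique e e∉V _ (≈ᵍ⇒≃ (proj₂ (p e e∉V')))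

    lapTerm-at : ∀ {v x} (x∈v : HalfEdgeAt Γ v x) → lapTerm M Γ g p v x ≡ proj₁ (p x (proj₂ x∈v))
    lapTerm-at {v} {x} (x↦v , x∉V) with r Γ x ≟ proj₁ v | r Γ x ≟ x
    ... | yes _    | no x∉V' = slope-irrelevant x x∉V' x∉V
    ... | yes _    | yes x∈V = ⊥-elim (x∉V x∈V)
    ... | no x↛v  | _       = ⊥-elim (x↛v x↦v)

    lapTerm-away : ∀ {v x} → ¬ HalfEdgeAt Γ v x → lapTerm M Γ g p v x ≡ + 0
    lapTerm-away {v} {x} x∉v with r Γ x ≟ proj₁ v | r Γ x ≟ x
    ... | yes x↦v | no x∉V = ⊥-elim (x∉v (x↦v , x∉V))
    ... | yes _    | yes _  = ≡.refl
    ... | no _     | _      = ≡.refl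

  module _ {Γ Γ' : MGraph M} (φ : Morphism M Γ Γ') where

    μ-irrelevant : ∀ e (e∉V e∉V' : ¬ IsVertex M Γ e) → slope M φ e e∉V ≡ slope M φ e e∉V'
    μ-irrelevant e e∉V e∉V' with edge φ e e∉V | edge φ e e∉V'
    ... | inj₁ (_ , _ , _ , μ , l'≈μl) | inj₁ (_ , _ , _ , μ' , l'≈μ'l) =
      ×-cancelʳ (length≉ε Γ e∉V) μ μ' (trans (sym l'≈μl) l'≈μ'l)
    ... | inj₁ (φe∉V , _) | inj₂ (φe∈V , _) = ⊥-elim (φe∉V φe∈V)
    ... | inj₂ (φe∈V , _) | inj₁ (φe∉V , _) = ⊥-elim (φe∉V φe∈V)
    ... | inj₂ _           | inj₂ _           = ≡.refl

    mTerm-at : ∀ {v x} (x∈v : HalfEdgeAt Γ v x) → mTerm M φ v (map φ x) x ≡ slope M φ x (proj₂ x∈v)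
    mTerm-at {v} {x} (x↦v , x∉V) with r Γ x ≟ proj₁ v | r Γ x ≟ x | map φ x ≟ map φ x
    ... | yes _   | no x∉V' | yes _ = μ-irrelevant x x∉V' x∉V
    ... | yes _   | no _    | no φx≢φx = ⊥-elim (φx≢φx ≡.refl)
    ... | yes _   | yes x∈V | _     = ⊥-elim (x∉V x∈V)
    ... | no x↛v | _       | _     = ⊥-elim (x↛v x↦v)

    mTerm-away : ∀ {v x} a → ¬ HalfEdgeAt Γ v x → mTerm M φ v a x ≡ 0
    mTerm-away {v} {x} a x∉v with r Γ x ≟ proj₁ v | r Γ x ≟ x | map φ x ≟ a
    ... | yes x↦v | no x∉V | yes _ = ⊥-elim (x∉v (x↦v , x∉V))
    ... | yes _    | no _   | no _  = ≡.refl
    ... | yes _    | yes _  | _     = ≡.refl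
    ... | no _     | _      | _     = ≡.refl

    mTerm-off-fibre : ∀ {v x a} → a ≢ map φ x → mTerm M φ v a x ≡ 0
    mTerm-off-fibre {v} {x} {a} a≢φx with r Γ x ≟ proj₁ v | r Γ x ≟ x | map φ x ≟ a
    ... | yes _ | no _  | yes φx≡a = ⊥-elim (a≢φx (≡.sym φx≡a))
    ... | yes _ | no _  | no _     = ≡.refl
    ... | yes _ | yes _ | _        = ≡.refl
    ... | no _  | _     | _        = ≡.refl

    module Pullback (g' : V M Γ' → Gp M) (p' : IsPL M Γ' g') (p : IsPL M Γ (pullPL M φ g')) where

      lapTerm' : V M Γ → Fin (size Γ') → ℤ
      lapTerm' v = lapTerm M Γ' g' p' (pullV M φ v)

      slope-pullback : ∀ {v x} (x∈v : HalfEdgeAt Γ v x) →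
                       proj₁ (p x (proj₂ x∈v)) ≡ lapTerm' v (map φ x) ℤ.* + slope M φ x (proj₂ x∈v)
      slope-pullback {v} {x} (x↦v , x∉V) with edge φ x x∉V
      ... | inj₂ (_ , φrx≡φx , φrix≡φx) =
        ≡.trans (slope-unique Γ (pullPL M φ g') p x x∉V (+ 0) constant-difference)
                (≡.sym (ℤ.*-zeroʳ (lapTerm' v (map φ x))))
        where
        ends-equal : pullV M φ (rV M Γ (i Γ x)) ≡ pullV M φ (rV M Γ x)
        ends-equal = V-≡ Γ' (≡.trans φrix≡φx (≡.sym φrx≡φx))
        constant-difference =
          ≃-trans (≃-reflexive (≡.cong (λ w → _⊖_ M (g' (pullV M φ (rV M Γ x))) (g' w)) ends-equal))
                  (⊖-self _ (l Γ x))
      ... | inj₁ (φx∉V , φrx≡rφx , φrix≡riφx , μ , l'≈μl) =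
        ≡.trans (slope-unique Γ (pullPL M φ g') p x x∉V (k' ℤ.* + μ) pulled-difference)
                (≡.cong (ℤ._* + μ) (≡.sym (lapTerm-at Γ' g' p' (φx↦φv , φx∉V))))
        where
        k' = proj₁ (p' (map φ x) φx∉V)
        φx↦φv = ≡.trans (≡.sym φrx≡rφx) (≡.cong (map φ) x↦v)
        pulled-difference =
          ≃-trans (≃-reflexive (≡.cong₂ (λ u w → _⊖_ M (g' u) (g' w))
                                         (V-≡ Γ' φrx≡rφx) (V-≡ Γ' φrix≡riφx)))
          (≃-trans (≈ᵍ⇒≃ (proj₂ (p' (map φ x) φx∉V)))
          (≃-trans (·-congʳ k' l'≈μl)
                   (·-assoc k' μ (l Γ x))))

      weighted-zero : ∀ {v a x} → mTerm M φ v a x ≡ 0 → lapTerm' v a ℤ.* + mTerm M φ v a x ≡ + 0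
      weighted-zero {v} {a} eq =
        ≡.trans (≡.cong (λ n → lapTerm' v a ℤ.* + n) eq) (ℤ.*-zeroʳ (lapTerm' v a))

      lapTerm-pullback : ∀ v x → lapTerm M Γ (pullPL M φ g') p v x ≡
                                  sum (λ a → lapTerm' v a ℤ.* + mTerm M φ v a x)
      lapTerm-pullback v x with halfEdgeAt? Γ v x
      ... | no x∉v = ≡.trans (lapTerm-away Γ (pullPL M φ g') p x∉v)
                             (≡.sym (sum-zero ℤ.+-0-monoid _ λ a → weighted-zero (mTerm-away a x∉v)))
      ... | yes x∈v = begin
        lapTerm M Γ (pullPL M φ g') p v x
          ≡⟨ lapTerm-at Γ (pullPL M φ g') p x∈v ⟩
        proj₁ (p x (proj₂ x∈v))
          ≡⟨ slope-pullback x∈v ⟩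
        lapTerm' v (map φ x) ℤ.* + slope M φ x (proj₂ x∈v)
          ≡⟨ ≡.cong (λ n → lapTerm' v (map φ x) ℤ.* + n) (mTerm-at x∈v) ⟨
        lapTerm' v (map φ x) ℤ.* + mTerm M φ v (map φ x) x
          ≡⟨ sum-single ℤ.+-0-monoid _ (map φ x) (λ a a≢φx → weighted-zero (mTerm-off-fibre a≢φx)) ⟨
        sum (λ a → lapTerm' v a ℤ.* + mTerm M φ v a x)
          ∎
        where open ≡-Reasoning

      lapTerm'-harmonic : ∀ {m} → IsHarmonicWith M φ m → ∀ v a →
                          lapTerm' v a ℤ.* + m v ≡ lapTerm' v a ℤ.* + mLoc M φ v a
      lapTerm'-harmonic {m} harmonic v a with halfEdgeAt? Γ' (pullV M φ v) a
      ... | yes (a↦φv , a∉V) = ≡.cong (λ n → lapTerm' v a ℤ.* + n) (≡.sym (harmonic v a a↦φv a∉V))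
      ... | no a∉φv = ≡.trans (≡.cong (λ k → k ℤ.* + m v) no-slope)
                              (≡.cong (λ k → k ℤ.* + mLoc M φ v a) (≡.sym no-slope))
        where no-slope = lapTerm-away Γ' g' p' a∉φv

      lapTerm'-mLoc : ∀ v a → lapTerm' v a ℤ.* + mLoc M φ v a ≡
                              sum (λ x → lapTerm' v a ℤ.* + mTerm M φ v a x)
      lapTerm'-mLoc v a = ≡.trans (≡.cong (lapTerm' v a ℤ.*_) (pos-Σℕ (mTerm M φ v a)))
                                  (*-distribˡ-sum (lapTerm' v a) (+_ ∘ mTerm M φ v a))

proposition3p5 : ∀ {c ℓ} (M : CommutativeMonoid c ℓ) → IsSharp M → IsIntegral M →
    (Γ Γ' : MGraph M) (φ : Morphism M Γ Γ') (m : V M Γ → ℕ) →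
    IsHarmonicWith M φ m → IsNonDegenerate M φ m →
    (g' : V M Γ' → Gp M) (p' : IsPL M Γ' g') (p : IsPL M Γ (pullPL M φ g')) →
    ∀ v → pullDiv M φ m (Lap M Γ' g' p') v ≡ Lap M Γ (pullPL M φ g') p v
proposition3p5 M sharp integral Γ Γ' φ m harmonic _ g' p' p v = begin
  pullDiv M φ m (Lap M Γ' g' p') v
    ≡⟨ ≡.cong (ℤ._* + m v) (Σℤ≡sum (lapTerm' v)) ⟩
  sum (lapTerm' v) ℤ.* + m v
    ≡⟨ *-distribʳ-sum (+ m v) (lapTerm' v) ⟩
  sum (λ a → lapTerm' v a ℤ.* + m v)
    ≡⟨ sum-cong-≗ (lapTerm'-harmonic harmonic v) ⟩
  sum (λ a → lapTerm' v a ℤ.* + mLoc M φ v a)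
    ≡⟨ sum-cong-≗ (lapTerm'-mLoc v) ⟩
  sum (λ a → sum (λ x → lapTerm' v a ℤ.* + mTerm M φ v a x))
    ≡⟨ ∑-comm (λ a x → lapTerm' v a ℤ.* + mTerm M φ v a x) ⟩
  sum (λ x → sum (λ a → lapTerm' v a ℤ.* + mTerm M φ v a x))
    ≡⟨ sum-cong-≗ (lapTerm-pullback v) ⟨
  sum (lapTerm M Γ (pullPL M φ g') p v)
    ≡⟨ Σℤ≡sum (lapTerm M Γ (pullPL M φ g') p v) ⟨
  Lap M Γ (pullPL M φ g') p v
    ∎
  where
  open ≡-Reasoning
  open Laplacian M sharp integral
  open Pullback φ g' p' p
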